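{- For every integer $N\ge1$ and every integer $M$ with $0\le M\le\binom{N}{2}$ such that there is no star-forest $F$ with $e(F)=N$ and $e(L(F))=M$, we have \[M \geq \binom{N-\left\lceil \frac{ -15+\sqrt{153+72N}}{2}\right\rceil}{2} > \frac{N^2}{2}-c_0N\sqrt{N}\] for some absolute positive constant $c_0$.
   Context: All graphs are finite and simple. A star-forest is a forest each of whose components is a star $K_{1,n_j}$ (possibly of different sizes). $L(F)$ is the line graph; for a star-forest $\bigcup_j K_{1,n_j}$ one has $e(F)=\sum_j n_j$ and $e(L(F))=\sum_j\binom{n_j}{2}$. -}

module Defs where

open import Data.Nat using (ℕ; _+_; _*_; _≤_; _<_)
open import Data.Nat.Combinatorics using (_C_)
open import Data.List using (List; map)
open import Data.Nat.ListAction using (sum)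
open import Relation.Binary.PropositionalEquality using (_≡_)
open import Data.List.Relation.Unary.All using (All)
open import Data.Product using (∃; _×_)

-- A star-forest ⋃_j K_{1,n_j} is recorded by the list of its component
-- sizes n_j (each star has at least one edge, n_j ≥ 1).
StarForest : Set
StarForest = List ℕ

IsStarForest : StarForest → Set
IsStarForest ns = All (1 ≤_) ns

edges : StarForest → ℕ
edges ns = sum ns

lineEdges : StarForest → ℕ
lineEdges ns = sum (map (_C 2) ns)

Realizable : ℕ → ℕ → Set
Realizable N M = ∃ λ ns → IsStarForest ns × edges ns ≡ N × lineEdges ns ≡ M

-- k = ⌈(-15 + √(153 + 72N)) / 2⌉, characterised as the least natural number k
-- with 153 + 72N ≤ (2k + 15)^2  (since 2k+15 > 0, 2k ≥ -15 + √(153+72N)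
-- iff (2k+15)^2 ≥ 153 + 72N; and the value is ≥ 0 for N ≥ 1).
IsCeilK : ℕ → ℕ → Set
IsCeilK N k = (153 + 72 * N ≤ (2 * k + 15) * (2 * k + 15))
            × (∀ j → j < k → (2 * j + 15) * (2 * j + 15) < 153 + 72 * N)

{-# OPTIONS --safe #-}

-- A value M below C(N − k, 2) is realised greedily: write M = C(n, 2) + r with r < n
-- and r = C(a, 2) + s with s < a, and take stars with n and a edges, s stars with two
-- edges (one line-graph edge each) and single edges up to N edges in total. This needs
-- n + a + 2s ≤ N, and as n < N − k, the inequality 18N ≤ k² + 15k + 18 defining k
-- leaves room for it. For the second bound, N² − 2 C(N − k, 2) ≤ (2k + 1) N while the
-- minimality of k gives (2k + 1)² < 256 N, so c = 8 works.

module Submission where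

open import Defs
open import Data.Nat using (ℕ; _+_; _*_; _∸_; _≤_; _<_; zero; suc; z≤n; s≤s; z<s)
open import Data.Nat.Properties
open import Data.Nat.Combinatorics using (_C_; nC1≡n; nCk+nC[k+1]≡[n+1]C[k+1])
open import Data.Nat.ListAction using (sum)
open import Data.Nat.ListAction.Properties using (sum-++)
open import Data.Nat.Tactic.RingSolver using (solve-∀)
open import Data.List using (List; _∷_; _++_; map; replicate)
open import Data.List.Properties using (map-++; map-replicate)
open import Data.List.Relation.Unary.All using (_∷_)
open import Data.List.Relation.Unary.All.Properties using (++⁺; replicate⁺)
open import Data.Product using (Σ; ∃; ∃₂; _×_; _,_)
open import Data.Sum using (inj₁; inj₂)
open import Relation.Nullary using (¬_)
open import Relation.Binary.PropositionalEquality
  using (_≡_; refl; sym; trans; cong; subst; module ≡-Reasoning)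

[1+n]C2≡n+nC2 : ∀ n → suc n C 2 ≡ n + n C 2
[1+n]C2≡n+nC2 n = trans (sym (nCk+nC[k+1]≡[n+1]C[k+1] n 1)) (cong (_+ n C 2) (nC1≡n n))

2*[1+n]C2≡[1+n]*n : ∀ n → 2 * (suc n C 2) ≡ suc n * n
2*[1+n]C2≡[1+n]*n zero    = refl
2*[1+n]C2≡[1+n]*n (suc n) = begin
  2 * (suc (suc n) C 2)       ≡⟨ cong (2 *_) ([1+n]C2≡n+nC2 (suc n)) ⟩
  2 * (suc n + suc n C 2)     ≡⟨ *-distribˡ-+ 2 (suc n) (suc n C 2) ⟩
  2 * suc n + 2 * (suc n C 2) ≡⟨ cong (2 * suc n +_) (2*[1+n]C2≡[1+n]*n n) ⟩
  2 * suc n + suc n * n       ≡⟨ ring n ⟩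
  suc (suc n) * suc n         ∎
  where
  open ≡-Reasoning
  ring : ∀ n → 2 * suc n + suc n * n ≡ suc (suc n) * suc n
  ring = solve-∀

2*nC2+n≡n*n : ∀ n → 2 * (n C 2) + n ≡ n * n
2*nC2+n≡n*n zero    = refl
2*nC2+n≡n*n (suc n) = begin
  2 * (suc n C 2) + suc n ≡⟨ cong (_+ suc n) (2*[1+n]C2≡[1+n]*n n) ⟩
  suc n * n + suc n       ≡⟨ +-comm (suc n * n) (suc n) ⟩
  suc n + suc n * n       ≡⟨ *-suc (suc n) n ⟨
  suc n * suc n           ∎
  where open ≡-Reasoning

C2-mono-≤ : ∀ {m n} → m ≤ n → m C 2 ≤ n C 2
C2-mono-≤ z≤n           = z≤n
C2-mono-≤ (s≤s {m} {n} m≤n) = begin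
  suc m C 2 ≡⟨ [1+n]C2≡n+nC2 m ⟩
  m + m C 2 ≤⟨ +-mono-≤ m≤n (C2-mono-≤ m≤n) ⟩
  n + n C 2 ≡⟨ [1+n]C2≡n+nC2 n ⟨
  suc n C 2 ∎
  where open ≤-Reasoning

C2-cancel-< : ∀ {m n} → m C 2 < n C 2 → m < n
C2-cancel-< mC2<nC2 = ≰⇒> (λ n≤m → <⇒≱ mC2<nC2 (C2-mono-≤ n≤m))

triangular-decomposition : ∀ M → ∃₂ λ n r → r < n × n C 2 + r ≡ M
triangular-decomposition zero = 1 , 0 , z<s , refl
triangular-decomposition (suc M) with triangular-decomposition M
... | n , r , r<n , refl with m≤n⇒m<n∨m≡n r<n
...   | inj₁ 1+r<n = n , suc r , 1+r<n , +-suc (n C 2) r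
...   | inj₂ refl  = suc (suc r) , 0 , z<s , (begin
  suc (suc r) C 2 + 0   ≡⟨ +-identityʳ _ ⟩
  suc (suc r) C 2       ≡⟨ [1+n]C2≡n+nC2 (suc r) ⟩
  suc r + suc r C 2     ≡⟨ cong suc (+-comm r _) ⟩
  suc (suc r C 2 + r)   ∎)
  where open ≡-Reasoning

m<n∸o⇒∃[d]m+d≡n×o<d : ∀ {m n o} → m < n ∸ o → ∃ λ d → m + d ≡ n × o < d
m<n∸o⇒∃[d]m+d≡n×o<d {m} {n} {o} m<n∸o =
  n ∸ m , m+[n∸m]≡n m≤n , m+n≤o⇒m≤o∸n (suc o) 1+o+m≤n
  where
  o<n : o < n
  o<n = m∸n≢0⇒n<m (n>0⇒n≢0 (≤-<-trans z≤n m<n∸o))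
  1+m+o≤n : suc m + o ≤ n
  1+m+o≤n = m≤o∸n⇒m+n≤o (suc m) (<⇒≤ o<n) m<n∸o
  1+o+m≤n : suc o + m ≤ n
  1+o+m≤n = ≤-trans (≤-reflexive (cong suc (+-comm o m))) 1+m+o≤n
  m≤n : m ≤ n
  m≤n = ≤-trans (m≤m+n m o) (<⇒≤ 1+m+o≤n)

sum-replicate : ∀ n x → sum (replicate n x) ≡ n * x
sum-replicate zero    x = refl
sum-replicate (suc n) x = cong (x +_) (sum-replicate n x)

lineEdges-++ : ∀ ms ns → lineEdges (ms ++ ns) ≡ lineEdges ms + lineEdges ns
lineEdges-++ ms ns =
  trans (cong sum (map-++ (_C 2) ms ns)) (sum-++ (map (_C 2) ms) (map (_C 2) ns))

lineEdges-replicate : ∀ n x → lineEdges (replicate n x) ≡ n * (x C 2)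
lineEdges-replicate n x = trans (cong sum (map-replicate (_C 2) n x)) (sum-replicate n (x C 2))

realizable-by-padding : ∀ {N} ns → IsStarForest ns → edges ns ≤ N →
                        Realizable N (lineEdges ns)
realizable-by-padding {N} ns forest fits =
  ns ++ singles , ++⁺ forest (replicate⁺ p ≤-refl) , edges-padded , lineEdges-padded
  where
  open ≡-Reasoning
  p : ℕ
  p = N ∸ edges ns
  singles : List ℕ
  singles = replicate p 1
  edges-singles : edges singles ≡ p
  edges-singles = trans (sum-replicate p 1) (*-identityʳ p)
  lineEdges-singles : lineEdges singles ≡ 0
  lineEdges-singles = trans (lineEdges-replicate p 1) (*-zeroʳ p)
  edges-padded : edges (ns ++ singles) ≡ N
  edges-padded = begin
    edges (ns ++ singles)     ≡⟨ sum-++ ns singles ⟩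
    edges ns + edges singles  ≡⟨ cong (edges ns +_) edges-singles ⟩
    edges ns + p              ≡⟨ m+[n∸m]≡n fits ⟩
    N                         ∎
  lineEdges-padded : lineEdges (ns ++ singles) ≡ lineEdges ns
  lineEdges-padded = begin
    lineEdges (ns ++ singles)         ≡⟨ lineEdges-++ ns singles ⟩
    lineEdges ns + lineEdges singles  ≡⟨ cong (lineEdges ns +_) lineEdges-singles ⟩
    lineEdges ns + 0                  ≡⟨ +-identityʳ _ ⟩
    lineEdges ns                      ∎

k*k+15*k<d*[d+21] : ∀ {k d} → k < d → k * k + 15 * k < d * (d + 21)
k*k+15*k<d*[d+21] {k} {d} k<d = begin-strict
  k * k + 15 * k                        <⟨ s≤s (m≤m+n _ (8 * k + 21)) ⟩
  suc (k * k + 15 * k + (8 * k + 21))   ≡⟨ ring k ⟩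
  suc k * (suc k + 21)                  ≤⟨ *-mono-≤ k<d (+-monoˡ-≤ 21 k<d) ⟩
  d * (d + 21)                          ∎
  where
  open ≤-Reasoning
  ring : ∀ k → suc (k * k + 15 * k + (8 * k + 21)) ≡ suc k * (suc k + 21)
  ring = solve-∀

-- If d ≤ 3b, then d (d + 3) ≤ 18 C(b+1, 2) < 18 n, and with k < d this
-- contradicts 18 (n + d) ≤ k² + 15k + 18.
small-stars-fit : ∀ {n d k b s} → 18 * (n + d) ≤ k * k + 15 * k + 18 → k < d →
                  suc b C 2 < n → s ≤ b → suc b + s * 2 ≤ d
small-stars-fit {n} {d} {k} {b} {s} room k<d [1+b]C2<n s≤b = begin
  suc b + s * 2   ≤⟨ +-monoʳ-≤ (suc b) (*-monoˡ-≤ 2 s≤b) ⟩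
  suc b + b * 2   ≡⟨ ring₁ b ⟩
  suc (3 * b)     ≤⟨ 3b<d ⟩
  d               ∎
  where
  open ≤-Reasoning
  T : ℕ
  T = suc b C 2
  ring₁ : ∀ b → suc b + b * 2 ≡ suc (3 * b)
  ring₁ = solve-∀
  ring₂ : ∀ b → 3 * b * (3 * b + 3) ≡ 9 * (suc b * b)
  ring₂ = solve-∀
  ring₃ : ∀ d → d * (d + 21) + 18 ≡ d * (d + 3) + 18 * d + 18
  ring₃ = solve-∀
  ring₄ : ∀ T d → 18 * T + 18 * d + 18 ≡ 18 * suc T + 18 * d
  ring₄ = solve-∀
  d*[d+3]≤18*T : d ≤ 3 * b → d * (d + 3) ≤ 18 * T
  d*[d+3]≤18*T d≤3b = begin
    d * (d + 3)             ≤⟨ *-mono-≤ d≤3b (+-monoˡ-≤ 3 d≤3b) ⟩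
    3 * b * (3 * b + 3)     ≡⟨ ring₂ b ⟩
    9 * (suc b * b)         ≡⟨ cong (9 *_) (2*[1+n]C2≡[1+n]*n b) ⟨
    9 * (2 * T)             ≡⟨ *-assoc 9 2 T ⟨
    18 * T                  ∎
  too-large : d ≤ 3 * b → d * (d + 21) + 18 ≤ k * k + 15 * k + 18
  too-large d≤3b = begin
    d * (d + 21) + 18           ≡⟨ ring₃ d ⟩
    d * (d + 3) + 18 * d + 18   ≤⟨ +-monoˡ-≤ 18 (+-monoˡ-≤ (18 * d) (d*[d+3]≤18*T d≤3b)) ⟩
    18 * T + 18 * d + 18        ≡⟨ ring₄ T d ⟩
    18 * suc T + 18 * d         ≤⟨ +-monoˡ-≤ (18 * d) (*-monoʳ-≤ 18 [1+b]C2<n) ⟩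
    18 * n + 18 * d             ≡⟨ *-distribˡ-+ 18 n d ⟨
    18 * (n + d)                ≤⟨ room ⟩
    k * k + 15 * k + 18         ∎
  3b<d : 3 * b < d
  3b<d = ≰⇒> (λ d≤3b → <⇒≱ (+-monoˡ-< 18 (k*k+15*k<d*[d+21] k<d)) (too-large d≤3b))

realizable-with-large-star : ∀ {n d k r} → 18 * (n + d) ≤ k * k + 15 * k + 18 → k < d →
                             r < n → Realizable (n + d) (n C 2 + r)
realizable-with-large-star {n} {d} {r = r} room k<d r<n with triangular-decomposition r
... | suc b , s , s≤s s≤b , refl =
  subst (Realizable (n + d)) (cong (λ x → n C 2 + (suc b C 2 + x)) cherry-lineEdges)
    (realizable-by-padding (n ∷ suc b ∷ cherries) forest fits)
  where
  cherries : List ℕ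
  cherries = replicate s 2
  cherry-lineEdges : lineEdges cherries ≡ s
  cherry-lineEdges = trans (lineEdges-replicate s 2) (*-identityʳ s)
  forest : IsStarForest (n ∷ suc b ∷ cherries)
  forest = ≤-trans z<s r<n ∷ z<s ∷ replicate⁺ s z<s
  [1+b]C2<n : suc b C 2 < n
  [1+b]C2<n = ≤-<-trans (m≤m+n (suc b C 2) s) r<n
  fits : edges (n ∷ suc b ∷ cherries) ≤ n + d
  fits = +-monoʳ-≤ n (begin
    suc b + edges cherries  ≡⟨ cong (suc b +_) (sum-replicate s 2) ⟩
    suc b + s * 2           ≤⟨ small-stars-fit room k<d [1+b]C2<n s≤b ⟩
    d                       ∎)
    where open ≤-Reasoning

realizable-below : ∀ {N k M} → 18 * N ≤ k * k + 15 * k + 18 → M < (N ∸ k) C 2 →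
                   Realizable N M
realizable-below {N} {k} {M} room M<[N∸k]C2 with triangular-decomposition M
... | n , r , r<n , refl
  with m<n∸o⇒∃[d]m+d≡n×o<d {n} {N} {k} (C2-cancel-< (≤-<-trans (m≤m+n (n C 2) r) M<[N∸k]C2))
...   | d , refl , k<d = realizable-with-large-star room k<d r<n

[2k+15]²≥153+72N⇒18N≤k²+15k+18 : ∀ N k → 153 + 72 * N ≤ (2 * k + 15) * (2 * k + 15) →
                                  18 * N ≤ k * k + 15 * k + 18
[2k+15]²≥153+72N⇒18N≤k²+15k+18 N k covers = *-cancelˡ-≤ 4 (+-cancelˡ-≤ 153 _ _ (begin
  153 + 4 * (18 * N)              ≡⟨ cong (153 +_) (*-assoc 4 18 N) ⟨
  153 + 72 * N                    ≤⟨ covers ⟩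
  (2 * k + 15) * (2 * k + 15)     ≡⟨ ring k ⟩
  153 + 4 * (k * k + 15 * k + 18) ∎))
  where
  open ≤-Reasoning
  ring : ∀ k → (2 * k + 15) * (2 * k + 15) ≡ 153 + 4 * (k * k + 15 * k + 18)
  ring = solve-∀

[k+m]²≤2*mC2+[2k+1]*[k+m] : ∀ k m → (k + m) * (k + m) ≤ 2 * (m C 2) + (2 * k + 1) * (k + m)
[k+m]²≤2*mC2+[2k+1]*[k+m] k m = +-cancelʳ-≤ m _ _ (begin
  (k + m) * (k + m) + m                    ≤⟨ m≤m+n _ (k * k + k) ⟩
  (k + m) * (k + m) + m + (k * k + k)      ≡⟨ ring₁ k m ⟩
  m * m + (2 * k + 1) * (k + m)            ≡⟨ cong (_+ (2 * k + 1) * (k + m)) (2*nC2+n≡n*n m) ⟨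
  2 * (m C 2) + m + (2 * k + 1) * (k + m)  ≡⟨ ring₂ (2 * (m C 2)) m k ⟩
  2 * (m C 2) + (2 * k + 1) * (k + m) + m  ∎)
  where
  open ≤-Reasoning
  ring₁ : ∀ k m → (k + m) * (k + m) + m + (k * k + k) ≡ m * m + (2 * k + 1) * (k + m)
  ring₁ = solve-∀
  ring₂ : ∀ t m k → t + m + (2 * k + 1) * (k + m) ≡ t + (2 * k + 1) * (k + m) + m
  ring₂ = solve-∀

N*N≤2*[N∸k]C2+[2k+1]*N : ∀ N k → N * N ≤ 2 * ((N ∸ k) C 2) + (2 * k + 1) * N
N*N≤2*[N∸k]C2+[2k+1]*N N k with ≤-total k N
... | inj₂ N≤k rewrite m≤n⇒m∸n≡0 N≤k =
  *-monoˡ-≤ N (≤-trans N≤k (≤-trans (m≤m+n k (1 * k)) (m≤m+n (2 * k) 1)))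
... | inj₁ k≤N with m≤n⇒∃[o]m+o≡n k≤N
...   | m , refl rewrite m+n∸m≡n k m = [k+m]²≤2*mC2+[2k+1]*[k+m] k m

[2k+1]²<256N : ∀ {N k} → 1 ≤ N →
               (∀ j → j < k → (2 * j + 15) * (2 * j + 15) < 153 + 72 * N) →
               (2 * k + 1) * (2 * k + 1) < 256 * N
[2k+1]²<256N {N} {zero}  1≤N _       = ≤-trans (s≤s (s≤s z≤n)) (*-monoʳ-≤ 256 1≤N)
[2k+1]²<256N {N} {suc j} 1≤N minimal = begin-strict
  (2 * suc j + 1) * (2 * suc j + 1) ≤⟨ *-mono-≤ shift shift ⟩
  (2 * j + 15) * (2 * j + 15)       <⟨ minimal j ≤-refl ⟩
  153 + 72 * N                      ≤⟨ +-monoˡ-≤ (72 * N) (*-monoʳ-≤ 153 1≤N) ⟩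
  153 * N + 72 * N                  ≡⟨ *-distribʳ-+ N 153 72 ⟨
  225 * N                           ≤⟨ *-monoˡ-≤ N (m≤m+n 225 31) ⟩
  256 * N                           ∎
  where
  open ≤-Reasoning
  ring : ∀ j → 2 * suc j + 1 + 12 ≡ 2 * j + 15
  ring = solve-∀
  shift : 2 * suc j + 1 ≤ 2 * j + 15
  shift = ≤-trans (m≤m+n (2 * suc j + 1) 12) (≤-reflexive (ring j))

X≤a*N∧a²<c*N⇒X²<c*N³ : ∀ {X a c} N → 1 ≤ N → X ≤ a * N → a * a < c * N →
                        X * X < c * (N * N * N)
X≤a*N∧a²<c*N⇒X²<c*N³ {X} {a} {c} N@(suc _) _ X≤aN a²<cN = begin-strict
  X * X                  ≤⟨ *-mono-≤ X≤aN X≤aN ⟩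
  (a * N) * (a * N)      ≡⟨ ring₁ a N ⟩
  (a * a) * (N * N)      <⟨ *-monoˡ-< (N * N) a²<cN ⟩
  (c * N) * (N * N)      ≡⟨ ring₂ c N ⟩
  c * (N * N * N)        ∎
  where
  open ≤-Reasoning
  ring₁ : ∀ a N → (a * N) * (a * N) ≡ (a * a) * (N * N)
  ring₁ = solve-∀
  ring₂ : ∀ c N → (c * N) * (N * N) ≡ c * (N * N * N)
  ring₂ = solve-∀

mainTheorem8 : Σ ℕ λ c → (1 ≤ c) ×
    (∀ N M → 1 ≤ N → M ≤ N C 2 → ¬ Realizable N M →
      ∀ k → IsCeilK N k →
        ((N ∸ k) C 2 ≤ M)
        × ((N * N ∸ 2 * ((N ∸ k) C 2)) * (N * N ∸ 2 * ((N ∸ k) C 2))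
            < 4 * (c * c) * (N * N * N)))
mainTheorem8 = 8 , s≤s z≤n , λ N M 1≤N _ unrealizable k (covers , minimal) →
    ≮⇒≥ (λ M<[N∸k]C2 → unrealizable
           (realizable-below {k = k} ([2k+15]²≥153+72N⇒18N≤k²+15k+18 N k covers) M<[N∸k]C2))
  , X≤a*N∧a²<c*N⇒X²<c*N³ {a = 2 * k + 1} {c = 256} N 1≤N
      (m≤n+o⇒m∸n≤o (N * N) _ (N*N≤2*[N∸k]C2+[2k+1]*N N k))
      ([2k+1]²<256N 1≤N minimal)
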